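{- Let $n\ge k\ge1$, and let $p^i_k,p^j_k\in\phi(n,k)$ with $j>i$, where $p^i_k$ is a major motif. Then $p^i_k\succeq p^j_k$.
   Context: A motif of $n$ is a finite non-increasing sequence $p=(p[1],\dots,p[k])$ of positive integers with sum $n$; $\phi(n,k)$ is the set of motifs of $n$ of length $k$. The motifs of $\phi(n,k)$ are listed in decreasing lexicographic order, and $p^i_k$ denotes the $i$-th motif in this list (so $p^1_k=(n-k+1,1,\dots,1)$). For motifs $p,q$ of $n$, $p\succeq q$ means $\sum_{x=1}^t p[x]\ge\sum_{x=1}^t q[x]$ for every $1\le t\le\min(|p|,|q|)$. A motif $p\in\phi(n,k)$ is major if there is an integer $\lambda$ with $\lceil n/k\rceil\le\lambda\le n-k+1$ and $\lambda\ge2$ such that, writing $\beta=\lfloor (n-k)/(\lambda-1)\rfloor$, one has $p[x]=\lambda$ for $1\le x\le\beta$, $p[\beta+1]=n-\beta\lambda-(k-\beta-1)$ (when $\beta+1\le k$), and $p[x]=1$ for $\beta+1<x\le k$. -}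

module Defs where

open import Data.Nat using (ℕ; zero; suc; _+_; _*_; _∸_; _≤_; _<_; _≥_; _<ᵇ_; _≡ᵇ_)
open import Data.Nat.DivMod using (_/_)
open import Data.List using (List; []; _∷_; length; take; map; upTo)
open import Data.Nat.ListAction using (sum)
open import Data.List.Relation.Unary.All using (All)
open import Data.List.Relation.Unary.Linked using (Linked)
open import Data.Bool using (if_then_else_)
open import Data.Product using (Σ; _×_)
open import Relation.Binary.PropositionalEquality using (_≡_)

NonIncreasing : List ℕ → Set
NonIncreasing = Linked (λ a b → b ≤ a)

IsMotif : ℕ → ℕ → List ℕ → Set
IsMotif n k p = NonIncreasing p × All (λ x → 1 ≤ x) p × sum p ≡ n × length p ≡ k

data _<lex_ : List ℕ → List ℕ → Set where
  []<∷  : ∀ {y ys} → [] <lex (y ∷ ys)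
  head< : ∀ {x y xs ys} → x < y → (x ∷ xs) <lex (y ∷ ys)
  tail< : ∀ {x y xs ys} → x ≡ y → xs <lex ys → (x ∷ xs) <lex (y ∷ ys)

LexDecreasing : List (List ℕ) → Set
LexDecreasing = Linked (λ p q → q <lex p)

_⪰_ : List ℕ → List ℕ → Set
p ⪰ q = ∀ t → 1 ≤ t → t ≤ length p → t ≤ length q → sum (take t q) ≤ sum (take t p)

-- ceiling of n / d (d ≥ 1); value at d = 0 is irrelevant
⌈_/_⌉ : ℕ → ℕ → ℕ
⌈ n / zero ⌉  = 0
⌈ n / suc d ⌉ = (n + d) / suc d

-- the candidate major motif of φ(n,k) with parameter λ ≥ 2:
-- β = ⌊(n-k)/(λ-1)⌋; entry x (1-indexed, here i = x - 1) is
-- λ if x ≤ β, n - βλ - (k-β-1) if x = β+1, and 1 otherwise.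
majorSeq : ℕ → ℕ → ℕ → List ℕ
majorSeq n k zero = []
majorSeq n k (suc zero) = []
majorSeq n k (suc (suc m)) = map entry (upTo k)
  where
    lam : ℕ
    lam = suc (suc m)
    β : ℕ
    β = (n ∸ k) / suc m
    entry : ℕ → ℕ
    entry i = if i <ᵇ β then lam
              else (if i ≡ᵇ β then n ∸ β * lam ∸ (k ∸ β ∸ 1) else 1)

IsMajor : ℕ → ℕ → List ℕ → Set
IsMajor n k p = Σ ℕ λ lam →
  (⌈ n / k ⌉ ≤ lam) × (lam ≤ n ∸ k + 1) × (2 ≤ lam) × (p ≡ majorSeq n k lam)

-- Lexicographic order bounds the first entry, so every later motif q of φ(n,k) has all
-- entries at most λ, the first entry of the major motif p. Up to position β the motif p
-- consists of λ's, so its prefix sums dominate those of q directly. Beyond β the motif p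
-- consists of 1's, so its suffix sums are minimal among motifs of length k; since both
-- motifs sum to n, the prefix sums of p again dominate.
module Submission where

open import Defs
open import Data.Nat using (ℕ; _≤_; _<_; zero; suc; _+_; _*_; _∸_; _<ᵇ_; _≡ᵇ_; z≤n; s≤s; z<s; s<s; _≤?_)
open import Data.Nat.Properties
open import Data.Nat.DivMod using (_/_)
open import Data.Nat.ListAction using (sum)
open import Data.Nat.ListAction.Properties using (sum-++)
open import Data.List using (List; []; _∷_; length; lookup; take; drop; applyUpTo)
open import Data.List.Properties using (map-upTo; length-take; length-drop; take++drop≡id)
open import Data.List.Membership.Propositional using (_∈_)
open import Data.List.Membership.Propositional.Properties using (∈-lookup)
open import Data.List.Relation.Unary.All as All using (All; []; _∷_)
open import Data.List.Relation.Unary.All.Properties using (take⁺; drop⁺; applyUpTo⁺₂)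
open import Data.List.Relation.Unary.Linked as Linked using (Linked; []; [-]; _∷_)
open import Data.Fin using (Fin; toℕ; zero; suc)
open import Data.Product using (_,_)
open import Data.Bool using (true; false; T; if_then_else_)
open import Data.Bool.Properties using (T-≡)
open import Data.Unit using (tt)
open import Data.Empty using (⊥-elim)
open import Relation.Nullary using (yes; no)
open import Relation.Binary using (Rel; Transitive)
open import Relation.Binary.PropositionalEquality
open import Function.Bundles using (_⇔_; Equivalence)

linked-lookup-< : ∀ {a ℓ} {A : Set a} {R : Rel A ℓ} → Transitive R →
                  ∀ {xs} → Linked R xs → (i j : Fin (length xs)) → toℕ i < toℕ j →
                  R (lookup xs i) (lookup xs j)
linked-lookup-< trans {_ ∷ _} l zero    (suc j) _         = Linked.lookup trans (Linked.tail l) (Linked.head′ l) j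
linked-lookup-< trans {_ ∷ _} l (suc i) (suc j) (s≤s i<j) = linked-lookup-< trans (Linked.tail l) i j i<j

All≤⇒sum≤length* : ∀ {c} l → All (_≤ c) l → sum l ≤ length l * c
All≤⇒sum≤length* []      []       = z≤n
All≤⇒sum≤length* (_ ∷ l) (x≤c ∷ a) = +-mono-≤ x≤c (All≤⇒sum≤length* l a)

All≥⇒length*≤sum : ∀ {c} l → All (c ≤_) l → length l * c ≤ sum l
All≥⇒length*≤sum []      []       = z≤n
All≥⇒length*≤sum (_ ∷ l) (c≤x ∷ a) = +-mono-≤ c≤x (All≥⇒length*≤sum l a)

sum-take+sum-drop : ∀ t l → sum (take t l) + sum (drop t l) ≡ sum l
sum-take+sum-drop t l = trans (sym (sum-++ (take t l) (drop t l))) (cong sum (take++drop≡id t l))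

sum-drop-≤⇒sum-take-≥ : ∀ t p q → sum q ≡ sum p → sum (drop t p) ≤ sum (drop t q) →
                        sum (take t q) ≤ sum (take t p)
sum-drop-≤⇒sum-take-≥ t p q sq≡sp drop≤ =
  +-cancelʳ-≤ (sum (drop t p)) (sum (take t q)) (sum (take t p)) (begin
    sum (take t q) + sum (drop t p) ≤⟨ +-monoʳ-≤ (sum (take t q)) drop≤ ⟩
    sum (take t q) + sum (drop t q) ≡⟨ sum-take+sum-drop t q ⟩
    sum q                           ≡⟨ sq≡sp ⟩
    sum p                           ≡⟨ sum-take+sum-drop t p ⟨
    sum (take t p) + sum (drop t p) ∎)
  where open ≤-Reasoning

sum-take-≤-of-bounds : ∀ {c} t p q → t ≤ length p →
                       All (_≤ c) q → All (c ≤_) (take t p) → sum (take t q) ≤ sum (take t p)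
sum-take-≤-of-bounds {c} t p q t≤|p| q≤c c≤p = begin
  sum (take t q)            ≤⟨ All≤⇒sum≤length* (take t q) (take⁺ t q≤c) ⟩
  length (take t q) * c     ≤⟨ *-monoˡ-≤ c (≤-trans (≤-reflexive (length-take t q)) (m⊓n≤m t (length q))) ⟩
  t * c                     ≡⟨ cong (_* c) (trans (sym (m≤n⇒m⊓n≡m t≤|p|)) (sym (length-take t p))) ⟩
  length (take t p) * c     ≤⟨ All≥⇒length*≤sum (take t p) c≤p ⟩
  sum (take t p)            ∎
  where open ≤-Reasoning

sum-take-≤-of-unit-tail : ∀ t p q → sum q ≡ sum p → length q ≡ length p →
                          All (1 ≤_) q → All (_≤ 1) (drop t p) → sum (take t q) ≤ sum (take t p)
sum-take-≤-of-unit-tail t p q sq≡sp |q|≡|p| 1≤q p≤1 = sum-drop-≤⇒sum-take-≥ t p q sq≡sp (begin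
  sum (drop t p)            ≤⟨ All≤⇒sum≤length* (drop t p) p≤1 ⟩
  length (drop t p) * 1     ≡⟨ cong (_* 1) (length-drop t p) ⟩
  (length p ∸ t) * 1        ≡⟨ cong (λ l → (l ∸ t) * 1) |q|≡|p| ⟨
  (length q ∸ t) * 1        ≡⟨ cong (_* 1) (length-drop t q) ⟨
  length (drop t q) * 1     ≤⟨ All≥⇒length*≤sum (drop t q) (drop⁺ t 1≤q) ⟩
  sum (drop t q)            ∎)
  where open ≤-Reasoning

take-applyUpTo⁺ : ∀ {P : ℕ → Set} f t k → (∀ {i} → i < t → P (f i)) → All P (take t (applyUpTo f k))
take-applyUpTo⁺ f zero    k       Pf = []
take-applyUpTo⁺ f (suc t) zero    Pf = []
take-applyUpTo⁺ f (suc t) (suc k) Pf = Pf z<s ∷ take-applyUpTo⁺ (λ i → f (suc i)) t k (λ i<t → Pf (s<s i<t))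

drop-applyUpTo⁺ : ∀ {P : ℕ → Set} f t k → (∀ {i} → t ≤ i → P (f i)) → All P (drop t (applyUpTo f k))
drop-applyUpTo⁺ f zero    k       Pf = applyUpTo⁺₂ f k (λ _ → Pf z≤n)
drop-applyUpTo⁺ f (suc t) zero    Pf = []
drop-applyUpTo⁺ f (suc t) (suc k) Pf = drop-applyUpTo⁺ (λ i → f (suc i)) t k (λ t≤i → Pf (s≤s t≤i))

head₀ : List ℕ → ℕ
head₀ []      = 0
head₀ (x ∷ _) = x

<lex⇒head₀≤ : ∀ {q p} → q <lex p → head₀ q ≤ head₀ p
<lex⇒head₀≤ []<∷            = z≤n
<lex⇒head₀≤ (head< x<y)     = <⇒≤ x<y
<lex⇒head₀≤ (tail< refl _)  = ≤-refl

lexDecreasing⇒head₀-antitone : ∀ {L} → LexDecreasing L → (i j : Fin (length L)) → toℕ i < toℕ j →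
                               head₀ (lookup L j) ≤ head₀ (lookup L i)
lexDecreasing⇒head₀-antitone l =
  linked-lookup-< (λ y≤x z≤y → ≤-trans z≤y y≤x) (Linked.map <lex⇒head₀≤ l)

nonIncreasing⇒All≤head₀ : ∀ {q} → NonIncreasing q → All (_≤ head₀ q) q
nonIncreasing⇒All≤head₀ []      = []
nonIncreasing⇒All≤head₀ [-]     = ≤-refl ∷ []
nonIncreasing⇒All≤head₀ (y≤x ∷ l) = ≤-refl ∷ All.map (λ z≤y → ≤-trans z≤y y≤x) (nonIncreasing⇒All≤head₀ l)

majorBlock : ℕ → ℕ → ℕ → ℕ
majorBlock n k m = (n ∸ k) / suc m

majorEntry : ℕ → ℕ → ℕ → ℕ → ℕ
majorEntry n k m i =
  if i <ᵇ β then suc (suc m) else (if i ≡ᵇ β then n ∸ β * suc (suc m) ∸ (k ∸ β ∸ 1) else 1)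
  where
  β : ℕ
  β = majorBlock n k m

majorSeq≡applyUpTo : ∀ n k m → majorSeq n k (suc (suc m)) ≡ applyUpTo (majorEntry n k m) k
majorSeq≡applyUpTo n k m = map-upTo (majorEntry n k m) k

majorEntry-< : ∀ n k m {i} → i < majorBlock n k m → majorEntry n k m i ≡ suc (suc m)
majorEntry-< n k m i<β rewrite Equivalence.to T-≡ (<⇒<ᵇ i<β) = refl

majorEntry-> : ∀ n k m {i} → majorBlock n k m < i → majorEntry n k m i ≡ 1
majorEntry-> n k m {i} β<i with i <ᵇ majorBlock n k m in i<ᵇβ | i ≡ᵇ majorBlock n k m in i≡ᵇβ
... | true  | _     = ⊥-elim (<-asym β<i (<ᵇ⇒< i _ (subst T (sym i<ᵇβ) tt)))
... | false | true  = ⊥-elim (<-irrefl (sym (≡ᵇ⇒≡ i _ (subst T (sym i≡ᵇβ) tt))) β<i)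
... | false | false = refl

majorSeq-head₀ : ∀ n k m → 1 ≤ k → 1 ≤ majorBlock n k m → head₀ (majorSeq n k (suc (suc m))) ≡ suc (suc m)
majorSeq-head₀ n (suc k) m _ 1≤β = majorEntry-< n (suc k) m 1≤β

majorSeq-⪰ : ∀ n k m q → IsMotif n k (majorSeq n k (suc (suc m))) → IsMotif n k q →
             head₀ q ≤ head₀ (majorSeq n k (suc (suc m))) → majorSeq n k (suc (suc m)) ⪰ q
majorSeq-⪰ n k m q (_ , _ , sp , lp) (nq , 1≤q , sq , lq) q₀≤p₀ t 1≤t t≤|p| _ with t ≤? majorBlock n k m
... | yes t≤β = sum-take-≤-of-bounds t p q t≤|p| q≤λ λ≤p
  where
  p : List ℕ
  p = majorSeq n k (suc (suc m))
  q≤λ : All (_≤ suc (suc m)) q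
  q≤λ = All.map (λ x≤q₀ → ≤-trans x≤q₀ (≤-trans q₀≤p₀ (≤-reflexive
          (majorSeq-head₀ n k m (≤-trans 1≤t (subst (t ≤_) lp t≤|p|)) (≤-trans 1≤t t≤β)))))
        (nonIncreasing⇒All≤head₀ nq)
  λ≤p : All (suc (suc m) ≤_) (take t p)
  λ≤p = subst (λ l → All _ (take t l)) (sym (majorSeq≡applyUpTo n k m))
          (take-applyUpTo⁺ (majorEntry n k m) t k
            (λ i<t → ≤-reflexive (sym (majorEntry-< n k m (<-≤-trans i<t t≤β)))))
... | no t≰β = sum-take-≤-of-unit-tail t p q (trans sq (sym sp)) (trans lq (sym lp)) 1≤q p≤1
  where
  p : List ℕ
  p = majorSeq n k (suc (suc m))
  p≤1 : All (_≤ 1) (drop t p)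
  p≤1 = subst (λ l → All _ (drop t l)) (sym (majorSeq≡applyUpTo n k m))
          (drop-applyUpTo⁺ (majorEntry n k m) t k
            (λ t≤i → ≤-reflexive (majorEntry-> n k m (<-≤-trans (≰⇒> t≰β) t≤i))))

mainTheorem9 : (n k : ℕ) → 1 ≤ k → k ≤ n →
    (L : List (List ℕ)) → (∀ p → (p ∈ L) ⇔ IsMotif n k p) → LexDecreasing L →
    (i j : Fin (length L)) → toℕ i < toℕ j →
    IsMajor n k (lookup L i) → lookup L i ⪰ lookup L j
mainTheorem9 _ _ _ _ _ _ _ _ _ _ (suc zero , _ , _ , s≤s () , _)
mainTheorem9 n k _ _ L motifs lexDec i j i<j (suc (suc m) , _ , _ , _ , p≡major) =
  subst (_⪰ lookup L j) (sym p≡major)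
    (majorSeq-⪰ n k m (lookup L j) (subst (IsMotif n k) p≡major (isMotif i)) (isMotif j)
      (subst (λ p → head₀ (lookup L j) ≤ head₀ p) p≡major (lexDecreasing⇒head₀-antitone lexDec i j i<j)))
  where
  isMotif : (x : Fin (length L)) → IsMotif n k (lookup L x)
  isMotif x = Equivalence.to (motifs (lookup L x)) (∈-lookup x)
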